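{- For every integer $r\ge 2$ and all $\gamma > 0$ and $\delta > 0$, every $G \in \mathcal{F}_{n,m}(K_{r+1};\delta,\gamma)$ admits a partition $\Pi=\{V_1,\dots,V_r\} \in \mathcal{P}_{n,r}(\gamma)$ such that $\sum_{i=1}^r e_G(V_i) \le \delta m$ and \[ \deg_G(v, V_i) \le \min_{j \ne i} \deg_G(v, V_j) \quad \text{for all } i \in [r] \text{ and } v \in V_i. \]
   Context: $\mathcal{F}_{n,m}(K_{r+1})$ is the family of $K_{r+1}$-free graphs on $[n]$ with exactly $m$ edges. $\mathcal{P}_{n,r}$ is the set of partitions of $[n]$ into at most $r$ parts, and $\mathcal{P}_{n,r}(\gamma)$ the set of partitions $\{V_1,\dots,V_r\}$ of $[n]$ with $(1/r-\gamma)n\le|V_i|\le(1/r+\gamma)n$ for all $i$. For $\delta,\gamma>0$, $\mathcal{F}_{n,m}(K_{r+1};\delta,\gamma)$ is the set of $G\in\mathcal{F}_{n,m}(K_{r+1})$ such that $\sum_i e_G(V_i)\le\delta m$ holds for some partition $\{V_1,\dots,V_r\}\in\mathcal{P}_{n,r}(\gamma)$ and for no partition in $\mathcal{P}_{n,r}\setminus\mathcal{P}_{n,r}(\gamma)$. Here $e_G(V_i)$ is the number of edges of $G$ inside $V_i$, and $\deg_G(v,A)$ is the number of neighbours of $v$ in $A$.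
   Formalization: The parameters γ and δ range over the positive rationals. -}

module Defs where

open import Data.Nat as ℕ using (ℕ; zero; suc)
open import Data.Fin using (Fin; zero; suc; toℕ)
open import Data.Bool using (Bool; true; false; _∧_; if_then_else_)
open import Data.Integer using (+_)
open import Data.Rational as ℚ using (ℚ; 0ℚ)
open import Data.Product using (Σ; _×_; _,_)
open import Relation.Binary.PropositionalEquality using (_≡_; _≢_)
open import Relation.Nullary using (¬_; does)
open import Function.Definitions using (Injective)

ℕtoℚ : ℕ → ℚ
ℕtoℚ n = + n ℚ./ 1

-- 1/r as a rational (value at 0 irrelevant: only used with r ≥ 2)
recip : ℕ → ℚ
recip zero = 0ℚ
recip (suc k) = + 1 ℚ./ suc k

count : ∀ {n} → (Fin n → Bool) → ℕ
count {zero} p = 0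
count {suc n} p = (if p zero then 1 else 0) ℕ.+ count (λ i → p (suc i))

sumFin : ∀ {n} → (Fin n → ℕ) → ℕ
sumFin {zero} f = 0
sumFin {suc n} f = f zero ℕ.+ sumFin (λ i → f (suc i))

record Graph (n : ℕ) : Set where
  field
    adj   : Fin n → Fin n → Bool
    sym   : ∀ u v → adj u v ≡ adj v u
    irrefl : ∀ v → adj v v ≡ false
open Graph public

_<ᵇF_ : ∀ {n} → Fin n → Fin n → Bool
u <ᵇF v = toℕ u ℕ.<ᵇ toℕ v

_≡ᵇF_ : ∀ {n} → Fin n → Fin n → Bool
u ≡ᵇF v = toℕ u ℕ.≡ᵇ toℕ v

edges : ∀ {n} → Graph n → ℕ
edges G = sumFin (λ u → count (λ v → (u <ᵇF v) ∧ adj G u v))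

KFree : ∀ {n} → ℕ → Graph n → Set
KFree {n} r G = ¬ (Σ (Fin (suc r) → Fin n) λ f →
                      Injective _≡_ _≡_ f × (∀ i j → i ≢ j → adj G (f i) (f j) ≡ true))

-- a partition of [n] into at most r (labelled, possibly empty) parts V_0..V_{r-1}
Partition : ℕ → ℕ → Set
Partition n r = Fin n → Fin r

inPart : ∀ {n r} → Partition n r → Fin r → Fin n → Bool
inPart P i v = P v ≡ᵇF i

partSize : ∀ {n r} → Partition n r → Fin r → ℕ
partSize P i = count (inPart P i)

eIn : ∀ {n} → Graph n → (Fin n → Bool) → ℕ
eIn G A = sumFin (λ u → count (λ v → (u <ᵇF v) ∧ adj G u v ∧ A u ∧ A v))

internalEdges : ∀ {n r} → Graph n → Partition n r → ℕ
internalEdges G P = sumFin (λ i → eIn G (inPart P i))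

degIn : ∀ {n} → Graph n → Fin n → (Fin n → Bool) → ℕ
degIn G v A = count (λ u → adj G v u ∧ A u)

Balanced : ∀ {n r} → ℚ → Partition n r → Set
Balanced {n} {r} γ P = ∀ i →
  ((recip r ℚ.- γ) ℚ.* ℕtoℚ n ℚ.≤ ℕtoℚ (partSize P i)) ×
  (ℕtoℚ (partSize P i) ℚ.≤ (recip r ℚ.+ γ) ℚ.* ℕtoℚ n)

Sparse : ∀ {n r} → Graph n → ℚ → ℕ → Partition n r → Set
Sparse G δ m P = ℕtoℚ (internalEdges G P) ℚ.≤ δ ℚ.* ℕtoℚ m

InF : ∀ n m r → ℚ → ℚ → Graph n → Set
InF n m r δ γ G =
  KFree r G × edges G ≡ m ×
  Σ (Partition n r) (λ P → Balanced γ P × Sparse G δ m P) ×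
  (∀ (P : Partition n r) → Sparse G δ m P → Balanced γ P)

-- Local search.  Moving a vertex v from its part V_i to another part V_j changes
-- Σ_k e(V_k) by exactly deg(v, V_j) − deg(v, V_i).  So starting from a partition
-- witnessing G ∈ F(δ, γ) and moving vertices while some vertex has fewer
-- neighbours in another part than in its own, the number of internal edges
-- strictly decreases; the process stops at a partition satisfying the degree
-- condition, which is still sparse and hence, by the definition of F(δ, γ),
-- balanced.  The exchange identity is proved for the ordered degree sum
-- Σ_v deg(v, own part) = 2 Σ_k e(V_k), which needs no bookkeeping of u < w.
module Submission where

open import Defs hiding (sym)
open import Data.Nat using (ℕ; _≥_; _≤_)
open import Data.Fin using (Fin)
open import Data.Rational using (ℚ; 0ℚ; _<_)
open import Data.Product using (Σ; _×_)
open import Relation.Binary.PropositionalEquality using (_≡_; _≢_)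

open import Data.Nat as ℕ using (zero; suc; _+_; _*_; _<ᵇ_)
open import Data.Nat.Properties
  using (+-identityʳ; +-comm; +-mono-≤-<; ≤-refl; ≤-trans; <⇒≤; ≰⇒>; ≮⇒≥;
         <-irrefl; <-cmp; <⇒<ᵇ; <ᵇ⇒<; ≡⇒≡ᵇ; ≡ᵇ⇒≡; *-distribˡ-+; *-cancelˡ-≡)
open import Data.Nat.Induction using (<-wellFounded)
open import Data.Nat.Coprimality using (1-coprimeTo) renaming (sym to coprime-sym)
open import Data.Nat.Solver using (module +-*-Solver)
open import Data.Fin using (zero; suc; toℕ; _≟_)
open import Data.Fin.Properties using (toℕ-injective; any?)
open import Data.Bool using (Bool; true; false; _∧_; if_then_else_)
open import Data.Bool.Properties using (T-≡; ∧-zeroʳ; ¬-not)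
import Data.Integer as ℤ
open import Data.Integer.Properties using (*-identityʳ)
open import Data.Rational as ℚ using (*≤*)
open import Data.Rational.Properties using (normalize-coprime) renaming (≤-trans to ℚ-≤-trans)
open import Data.Product using (_,_)
open import Function.Base using (_∘_)
open import Function.Bundles using (Equivalence)
open import Induction.WellFounded using (Acc; acc)
open import Relation.Binary.Definitions using (tri<; tri≈; tri>)
open import Relation.Nullary using (¬_; yes; no)
open import Relation.Binary.PropositionalEquality
  using (refl; sym; trans; cong; cong₂; subst₂; module ≡-Reasoning)

open Equivalence using (to; from)
open +-*-Solver using (solve; _:+_; _:=_)

ind : Bool → ℕ
ind b = if b then 1 else 0

count-as-sumFin : ∀ {n} (p : Fin n → Bool) → count p ≡ sumFin (λ v → ind (p v))
count-as-sumFin {zero}  p = refl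
count-as-sumFin {suc n} p = cong (ind (p zero) +_) (count-as-sumFin (λ i → p (suc i)))

sumFin-cong : ∀ {n} {f g : Fin n → ℕ} → (∀ i → f i ≡ g i) → sumFin f ≡ sumFin g
sumFin-cong {zero}  f≗g = refl
sumFin-cong {suc n} f≗g = cong₂ _+_ (f≗g zero) (sumFin-cong (λ i → f≗g (suc i)))

sumFin-zero : ∀ n → sumFin {n} (λ _ → 0) ≡ 0
sumFin-zero zero    = refl
sumFin-zero (suc n) = sumFin-zero n

sumFin-+ : ∀ {n} (f g : Fin n → ℕ) → sumFin (λ i → f i + g i) ≡ sumFin f + sumFin g
sumFin-+ {zero}  f g = refl
sumFin-+ {suc n} f g =
  trans (cong (f zero + g zero +_) (sumFin-+ (λ i → f (suc i)) (λ i → g (suc i))))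
        (interchange (f zero) (g zero) _ _)
  where
  interchange : ∀ a b c d → (a + b) + (c + d) ≡ (a + c) + (b + d)
  interchange = solve 4 (λ a b c d → (a :+ b) :+ (c :+ d) := (a :+ c) :+ (b :+ d)) refl

sumFin²-+ : ∀ {m n} (f g : Fin m → Fin n → ℕ) →
  sumFin (λ u → sumFin (λ w → f u w + g u w)) ≡
  sumFin (λ u → sumFin (f u)) + sumFin (λ u → sumFin (g u))
sumFin²-+ f g =
  trans (sumFin-cong (λ u → sumFin-+ (f u) (g u)))
        (sumFin-+ (λ u → sumFin (f u)) (λ u → sumFin (g u)))

sumFin-swap : ∀ {m n} (f : Fin m → Fin n → ℕ) →
  sumFin (λ i → sumFin (f i)) ≡ sumFin (λ u → sumFin (λ i → f i u))
sumFin-swap {zero}  {n} f = sym (sumFin-zero n)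
sumFin-swap {suc m} f =
  trans (cong (sumFin (f zero) +_) (sumFin-swap (λ i → f (suc i))))
        (sym (sumFin-+ (f zero) (λ u → sumFin (λ i → f (suc i) u))))

sumFin-if : ∀ {n} (c : Bool) (k : Fin n → ℕ) →
  sumFin (λ w → if c then k w else 0) ≡ (if c then sumFin k else 0)
sumFin-if         true  k = refl
sumFin-if {n = n} false k = sumFin-zero n

sumFin-select : ∀ {r} (x : Fin r) (g : Fin r → ℕ) →
  sumFin (λ i → if x ≡ᵇF i then g i else 0) ≡ g x
sumFin-select {suc r} zero    g = trans (cong (g zero +_) (sumFin-zero r)) (+-identityʳ _)
sumFin-select {suc r} (suc x) g = sumFin-select x (λ i → g (suc i))

≡ᵇF-refl : ∀ {n} (x : Fin n) → (x ≡ᵇF x) ≡ true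
≡ᵇF-refl x = to T-≡ (≡⇒≡ᵇ (toℕ x) (toℕ x) refl)

≡ᵇF-≢ : ∀ {n} {x y : Fin n} → x ≢ y → (x ≡ᵇF y) ≡ false
≡ᵇF-≢ x≢y = ¬-not (λ eq → x≢y (toℕ-injective (≡ᵇ⇒≡ _ _ (from T-≡ eq))))

≡ᵇF-sym : ∀ {n} (x y : Fin n) → (x ≡ᵇF y) ≡ (y ≡ᵇF x)
≡ᵇF-sym zero    zero    = refl
≡ᵇF-sym zero    (suc y) = refl
≡ᵇF-sym (suc x) zero    = refl
≡ᵇF-sym (suc x) (suc y) = ≡ᵇF-sym x y

<ᵇ-true : ∀ {m n} → m ℕ.< n → (m <ᵇ n) ≡ true
<ᵇ-true m<n = to T-≡ (<⇒<ᵇ m<n)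

<ᵇ-false : ∀ {m n} → ¬ (m ℕ.< n) → (m <ᵇ n) ≡ false
<ᵇ-false m≮n = ¬-not (λ eq → m≮n (<ᵇ⇒< _ _ (from T-≡ eq)))

ℕtoℚ-mono-≤ : ∀ {a b} → a ≤ b → ℕtoℚ a ℚ.≤ ℕtoℚ b
ℕtoℚ-mono-≤ {a} {b} a≤b
  rewrite normalize-coprime (coprime-sym (1-coprimeTo a))
        | normalize-coprime (coprime-sym (1-coprimeTo b)) =
  *≤* (subst₂ ℤ._≤_ (sym (*-identityʳ (ℤ.+ a))) (sym (*-identityʳ (ℤ.+ b)))
              (ℤ.+≤+ a≤b))

module _ {n : ℕ} (R : Fin n → Fin n → Bool) where

  orderedCount : ℕ
  orderedCount = sumFin (λ u → count (R u))

  unorderedCount : ℕ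
  unorderedCount = sumFin (λ u → count (λ w → (u <ᵇF w) ∧ R u w))

  module _ (R-sym : ∀ u w → R u w ≡ R w u) (R-irrefl : ∀ u → R u u ≡ false) where

    ind-split-by-order : ∀ u w →
      ind (R u w) ≡ ind ((u <ᵇF w) ∧ R u w) + ind ((w <ᵇF u) ∧ R w u)
    ind-split-by-order u w with <-cmp (toℕ u) (toℕ w)
    ... | tri< u<w _ w≮u rewrite <ᵇ-true u<w | <ᵇ-false w≮u = sym (+-identityʳ _)
    ... | tri> u≮w _ w<u rewrite <ᵇ-false u≮w | <ᵇ-true w<u | R-sym u w = refl
    ... | tri≈ _ u≡w _ with toℕ-injective u≡w
    ...   | refl rewrite R-irrefl u | ∧-zeroʳ (u <ᵇF u) = refl

    handshake : orderedCount ≡ 2 * unorderedCount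
    handshake = begin
        sumFin (λ u → count (R u))
      ≡⟨ sumFin-cong (λ u → trans (count-as-sumFin (R u))
                                  (trans (sumFin-cong (ind-split-by-order u))
                                         (sumFin-+ {n} _ _))) ⟩
        sumFin (λ u → sumFin (λ w → ind ((u <ᵇF w) ∧ R u w))
                     + sumFin (λ w → ind ((w <ᵇF u) ∧ R w u)))
      ≡⟨ sumFin-+ {n} _ _ ⟩
        below + sumFin (λ u → sumFin (λ w → ind ((w <ᵇF u) ∧ R w u)))
      ≡⟨ cong (below +_) (sumFin-swap (λ u w → ind ((w <ᵇF u) ∧ R w u))) ⟩
        below + below
      ≡⟨ cong (below +_) (sym (+-identityʳ below)) ⟩
        2 * below
      ≡⟨ cong (2 *_) (sym (sumFin-cong {n} (λ u → count-as-sumFin {n} _))) ⟩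
        2 * unorderedCount
      ∎
      where
      open ≡-Reasoning
      below = sumFin (λ u → sumFin (λ w → ind ((u <ᵇF w) ∧ R u w)))

module _ {n r : ℕ} (G : Graph n) where

  sameAdj : Partition n r → Fin n → Fin n → Bool
  sameAdj P u w = adj G u w ∧ inPart P (P u) w

  internalEdges≡unorderedCount : ∀ P → internalEdges G P ≡ unorderedCount (sameAdj P)
  internalEdges≡unorderedCount P = begin
      sumFin (λ i → sumFin (λ u → count (λ w → internal i u w)))
    ≡⟨ sumFin-cong {r} (λ i → sumFin-cong {n} (λ u → count-as-sumFin {n} _)) ⟩
      sumFin (λ i → sumFin (λ u → sumFin (λ w → ind (internal i u w))))
    ≡⟨ sumFin-swap (λ i u → sumFin (λ w → ind (internal i u w))) ⟩
      sumFin (λ u → sumFin (λ i → sumFin (λ w → ind (internal i u w))))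
    ≡⟨ sumFin-cong (λ u → sumFin-swap (λ i w → ind (internal i u w))) ⟩
      sumFin (λ u → sumFin (λ w → sumFin (λ i → ind (internal i u w))))
    ≡⟨ sumFin-cong (λ u → sumFin-cong (λ w →
         trans (sumFin-cong (λ i → ind-select (u <ᵇF w) (adj G u w) (P u ≡ᵇF i) (P w ≡ᵇF i)))
               (sumFin-select (P u) (λ i → ind ((u <ᵇF w) ∧ adj G u w ∧ (P w ≡ᵇF i)))))) ⟩
      sumFin (λ u → sumFin (λ w → ind ((u <ᵇF w) ∧ sameAdj P u w)))
    ≡⟨ sym (sumFin-cong {n} (λ u → count-as-sumFin {n} _)) ⟩
      unorderedCount (sameAdj P)
    ∎
    where
    open ≡-Reasoning
    internal : Fin r → Fin n → Fin n → Bool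
    internal i u w = (u <ᵇF w) ∧ adj G u w ∧ (P u ≡ᵇF i) ∧ (P w ≡ᵇF i)
    ind-select : ∀ a b c d → ind (a ∧ b ∧ c ∧ d) ≡ (if c then ind (a ∧ b ∧ d) else 0)
    ind-select a b true  d = refl
    ind-select a b false d = cong ind (trans (cong (a ∧_) (∧-zeroʳ b)) (∧-zeroʳ a))

  degreeSum≡2*internalEdges : ∀ P → orderedCount (sameAdj P) ≡ 2 * internalEdges G P
  degreeSum≡2*internalEdges P =
    trans (handshake (sameAdj P) sameAdj-sym (λ u → cong (_∧ _) (irrefl G u)))
          (cong (2 *_) (sym (internalEdges≡unorderedCount P)))
    where
    sameAdj-sym : ∀ u w → sameAdj P u w ≡ sameAdj P w u
    sameAdj-sym u w = cong₂ _∧_ (Graph.sym G u w) (≡ᵇF-sym (P w) (P u))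

  move : Partition n r → Fin n → Fin r → Partition n r
  move P v j u = if v ≡ᵇF u then j else P u

  rowCol : Fin n → (Fin n → ℕ) → Fin n → Fin n → ℕ
  rowCol v k u w = (if v ≡ᵇF u then k w else 0) + (if v ≡ᵇF w then k u else 0)

  sumFin²-rowCol : ∀ v k → sumFin (λ u → sumFin (rowCol v k u)) ≡ 2 * sumFin k
  sumFin²-rowCol v k = begin
      sumFin (λ u → sumFin (rowCol v k u))
    ≡⟨ sumFin²-+ (λ u w → if v ≡ᵇF u then k w else 0) (λ u w → if v ≡ᵇF w then k u else 0) ⟩
      sumFin (λ u → sumFin (λ w → if v ≡ᵇF u then k w else 0))
        + sumFin (λ u → sumFin (λ w → if v ≡ᵇF w then k u else 0))
    ≡⟨ cong₂ _+_ (trans (sumFin-cong (λ u → sumFin-if (v ≡ᵇF u) k))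
                        (sumFin-select v (λ _ → sumFin k)))
                 (sumFin-cong (λ u → sumFin-select v (λ _ → k u))) ⟩
      sumFin k + sumFin k
    ≡⟨ cong (sumFin k +_) (sym (+-identityʳ (sumFin k))) ⟩
      2 * sumFin k
    ∎
    where open ≡-Reasoning

  -- Moving v to V_j only changes the row and the column of v, where the
  -- neighbours of v in its old part are traded for those in V_j.
  ind-sameAdj-move : ∀ P v j u w →
    ind (sameAdj (move P v j) u w) + rowCol v (λ x → ind (sameAdj P v x)) u w ≡
    ind (sameAdj P u w) + rowCol v (λ x → ind (adj G v x ∧ inPart P j x)) u w
  ind-sameAdj-move P v j u w with v ≟ u | v ≟ w
  ... | yes refl | yes refl rewrite ≡ᵇF-refl v | irrefl G v = refl
  ... | yes refl | no v≢w rewrite ≡ᵇF-refl v | ≡ᵇF-≢ v≢w =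
    swap-+0 (ind (adj G v w ∧ inPart P j w)) (ind (sameAdj P v w))
    where
    swap-+0 : ∀ a b → a + (b + 0) ≡ b + (a + 0)
    swap-+0 a b rewrite +-identityʳ a | +-identityʳ b = +-comm a b
  ... | no v≢u | yes refl rewrite ≡ᵇF-refl v | ≡ᵇF-≢ v≢u | Graph.sym G u v
                                | ≡ᵇF-sym j (P u) | ≡ᵇF-sym (P v) (P u) =
    +-comm (ind (adj G v u ∧ inPart P j u)) (ind (sameAdj P v u))
  ... | no v≢u | no v≢w rewrite ≡ᵇF-≢ v≢u | ≡ᵇF-≢ v≢w = refl

  internalEdges-move : ∀ P v j →
    internalEdges G (move P v j) + degIn G v (inPart P (P v)) ≡
    internalEdges G P + degIn G v (inPart P j)
  internalEdges-move P v j = *-cancelˡ-≡ _ _ 2 (begin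
      2 * (internalEdges G (move P v j) + count old)
    ≡⟨ *-distribˡ-+ 2 (internalEdges G (move P v j)) (count old) ⟩
      2 * internalEdges G (move P v j) + 2 * count old
    ≡⟨ cong₂ _+_ (doubledInternal (move P v j)) (doubled old) ⟩
      sumFin (λ u → sumFin (λ w → ind (sameAdj (move P v j) u w)))
        + sumFin (λ u → sumFin (rowCol v (ind ∘ old) u))
    ≡⟨ sym (sumFin²-+ (λ u w → ind (sameAdj (move P v j) u w)) (rowCol v (ind ∘ old))) ⟩
      sumFin (λ u → sumFin (λ w → ind (sameAdj (move P v j) u w) + rowCol v (ind ∘ old) u w))
    ≡⟨ sumFin-cong (λ u → sumFin-cong (ind-sameAdj-move P v j u)) ⟩
      sumFin (λ u → sumFin (λ w → ind (sameAdj P u w) + rowCol v (ind ∘ new) u w))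
    ≡⟨ sumFin²-+ (λ u w → ind (sameAdj P u w)) (rowCol v (ind ∘ new)) ⟩
      sumFin (λ u → sumFin (λ w → ind (sameAdj P u w)))
        + sumFin (λ u → sumFin (rowCol v (ind ∘ new) u))
    ≡⟨ cong₂ _+_ (sym (doubledInternal P)) (sym (doubled new)) ⟩
      2 * internalEdges G P + 2 * count new
    ≡⟨ sym (*-distribˡ-+ 2 (internalEdges G P) _) ⟩
      2 * (internalEdges G P + count new)
    ∎)
    where
    open ≡-Reasoning
    old new : Fin n → Bool
    old = sameAdj P v
    new x = adj G v x ∧ inPart P j x
    doubledInternal : ∀ Q →
      2 * internalEdges G Q ≡ sumFin (λ u → sumFin (λ w → ind (sameAdj Q u w)))
    doubledInternal Q =
      trans (sym (degreeSum≡2*internalEdges Q)) (sumFin-cong (λ u → count-as-sumFin (sameAdj Q u)))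
    doubled : ∀ p → 2 * count p ≡ sumFin (λ u → sumFin (rowCol v (ind ∘ p) u))
    doubled p = trans (cong (2 *_) (count-as-sumFin p)) (sym (sumFin²-rowCol v (ind ∘ p)))

  internalEdges-move-< : ∀ P v j →
    degIn G v (inPart P j) ℕ.< degIn G v (inPart P (P v)) →
    internalEdges G (move P v j) ℕ.< internalEdges G P
  internalEdges-move-< P v j fewer = ≰⇒> λ moved≥ →
    <-irrefl (sym (internalEdges-move P v j)) (+-mono-≤-< moved≥ fewer)

  LocallyOptimal : Partition n r → Set
  LocallyOptimal P = ∀ v j → degIn G v (inPart P (P v)) ≤ degIn G v (inPart P j)

  locallyOptimalBelow : ∀ P → Acc ℕ._<_ (internalEdges G P) →
    Σ (Partition n r) λ Q → internalEdges G Q ≤ internalEdges G P × LocallyOptimal Q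
  locallyOptimalBelow P (acc smaller)
    with any? (λ v → any? (λ j → degIn G v (inPart P j) ℕ.<? degIn G v (inPart P (P v))))
  ... | yes (v , j , fewer) =
    let decrease = internalEdges-move-< P v j fewer
        Q , Q≤ , optimal = locallyOptimalBelow (move P v j) (smaller decrease)
    in Q , ≤-trans Q≤ (<⇒≤ decrease) , optimal
  ... | no none = P , ≤-refl , λ v j → ≮⇒≥ (λ fewer → none (v , j , fewer))

claim6p2 : ∀ (r : ℕ) → r ≥ 2 → ∀ (γ δ : ℚ) → 0ℚ < γ → 0ℚ < δ →
    ∀ (n m : ℕ) (G : Graph n) → InF n m r δ γ G →
    Σ (Partition n r) λ P → Balanced γ P × Sparse G δ m P ×
      (∀ (i : Fin r) (v : Fin n) → P v ≡ i →
         ∀ (j : Fin r) → j ≢ i → degIn G v (inPart P i) ≤ degIn G v (inPart P j))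
claim6p2 r _ γ δ _ _ n m G (_ , _ , (P₀ , _ , sparse₀) , sparse⇒balanced)
  with locallyOptimalBelow G P₀ (<-wellFounded _)
... | Q , Q≤P₀ , optimal =
  Q , sparse⇒balanced Q sparse , sparse , λ { i v refl j _ → optimal v j }
  where
  sparse : Sparse G δ m Q
  sparse = ℚ-≤-trans (ℕtoℚ-mono-≤ Q≤P₀) sparse₀
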